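{- Let $E\in\mathcal P^e$. Then: (1) if $E\xrightarrow{\mu}E'$ then $Unl(E)\xrightarrow{\mu}Unl(E')$; (2) if $Unl(E)\xrightarrow{\mu}P'$ then there exists $E'\in\mathcal P^e$ such that $E\xrightarrow{\mu}E'$ and $Unl(E')=P'$.
   Context: Unlabeled processes. Let $\mathcal N$ be an infinite set of names. The set $\mathcal P$ of processes is generated by $P::=0\mid x(y).P\mid \bar xy.P\mid P\,|\,P\mid(\nu x)P\mid\, !P$ ($x,y\in\mathcal N$); $x(y).P$ and $(\nu x)P$ bind $y$, resp. $x$; free names $fn$, bound names $bn$ and $n(\cdot)=fn(\cdot)\cup bn(\cdot)$ are as usual, and terms are considered up to alpha-conversion. Actions $\mu$ are $xy$ (input), $\bar xy$ (output), $\bar x(y)$ (bound output) and $\tau$, with $bn(\bar x(y))=\{y\}$, $bn(\mu)=\emptyset$ otherwise, $fn(xy)=fn(\bar xy)=\{x,y\}$, $fn(\bar x(y))=\{x\}$, $fn(\tau)=\emptyset$. The (early) transition relation $\xrightarrow{\mu}$ is the least relation closed under: Input $x(y).P\xrightarrow{xz}P\{z/y\}$; Output $\bar xy.P\xrightarrow{\bar xy}P$; Open: $P\xrightarrow{\bar xy}P'$, $x\neq y$ imply $(\nu y)P\xrightarrow{\bar x(y)}P'$; Res: $P\xrightarrow{\mu}P'$, $y\notin n(\mu)$ imply $(\nu y)P\xrightarrow{\mu}(\nu y)P'$; Par: $P\xrightarrow{\mu}P'$, $bn(\mu)\cap fn(Q)=\emptyset$ imply $P|Q\xrightarrow{\mu}P'|Q$;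 Com: $P\xrightarrow{xy}P'$, $Q\xrightarrow{\bar xy}Q'$ imply $P|Q\xrightarrow{\tau}P'|Q'$; Close: $P\xrightarrow{xy}P'$, $Q\xrightarrow{\bar x(y)}Q'$, $y\notin fn(P)$ imply $P|Q\xrightarrow{\tau}(\nu y)(P'|Q')$; the symmetric versions of Par, Com, Close; Rep: $P\xrightarrow{\mu}P'$ implies $!P\xrightarrow{\mu}P'|!P$. Labeled terms. Labels are pairs $\langle s,n\rangle\in\{0,1\}^*\times\mathbb N$. For strings, $s_0\sqsubseteq s_1$ means $s_0$ is a prefix of $s_1$. For sets of labels, $L_0\,\Re\,L_1$ iff for all $\langle s_0,n_0\rangle\in L_0$ and $\langle s_1,n_1\rangle\in L_1$ we have $s_0\not\sqsubseteq s_1$ and $s_1\not\sqsubseteq s_0$. Ground labeled terms $\mathcal P^e_{gr}$: $E::=0\mid \mu_{\langle s,n\rangle}.E\mid(\nu x)E\mid E\,|\,E\mid\, !_{\langle s,n\rangle}P$, where $\mu$ is a prefix $x(y)$ or $\bar xy$ and $P\in\mathcal P$ is unlabeled. The labeling function: $L_{\langle s,n\rangle}(0)=0$; $L_{\langle s,n\rangle}(\mu.P)=\mu_{\langle s,n\rangle}.L_{\langle s,n+1\rangle}(P)$; $L_{\langle s,n\rangle}(P_0|P_1)=L_{\langle s0,n\rangle}(P_0)\,|\,L_{\langle s1,n\rangle}(P_1)$; $L_{\langle s,n\rangle}((\nu x)P)=(\nu x)L_{\langle s,n\rangle}(P)$; $L_{\langle s,n\rangle}(!P)=\,!_{\langle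 s,n\rangle}P$. $top(0)=lab(0)=\emptyset$; $top(\mu_v.E)=\{v\}$, $lab(\mu_v.E)=\{v\}\cup lab(E)$; $top$, $lab$ of $(\nu x)E$ equal those of $E$; $top(E_0|E_1)=top(E_0)\cup top(E_1)$, $lab(E_0|E_1)=lab(E_0)\cup lab(E_1)$; $top(!_vP)=lab(!_vP)=\{v\}$. The predicate $wf$ is the least one with: $wf(0)$; $wf(L_{\langle s,n\rangle}(\mu.P))$ for every $\mu.P\in\mathcal P$ and label; $wf(E_0|E_1)$ if $wf(E_0)$, $wf(E_1)$, $top(E_0)\,\Re\,top(E_1)$; $wf((\nu x)E)$ if $wf(E)$; $wf(!_{\langle s,n\rangle}P)$ for every $P\in\mathcal P$ and label. $\mathcal P^e=\{E\in\mathcal P^e_{gr}: wf(E)\}$. Labeled transitions use the unlabeled rules with labels ignored (e.g. $x(y)_v.E\xrightarrow{xz}E\{z/y\}$, $\bar xy_v.E\xrightarrow{\bar xy}E$), except replication: if $P\xrightarrow{\mu}P'$ in the unlabeled semantics then $!_{\langle s,n\rangle}P\xrightarrow{\mu}L_{\langle s0,n+1\rangle}(P')\,|\,!_{\langle s1,n+1\rangle}P$. $Unl(E)\in\mathcal P$ is obtained by removing all labels: $Unl(0)=0$, $Unl(\mu_v.E)=\mu.Unl(E)$, $Unl(E_0|E_1)=Unl(E_0)|Unl(E_1)$, $Unl((\nu x)E)=(\nu x)Unl(E)$, $Unl(!_vP)=\,!P$. -}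

module Defs where

open import Data.Nat using (ℕ; zero; suc)
open import Data.Bool using (Bool; true; false)
open import Data.List using (List; []; _∷_; _++_)
open import Data.List.Membership.Propositional using (_∈_)
open import Data.Product using (_×_; _,_; Σ)
open import Relation.Binary.PropositionalEquality using (_≡_)
open import Relation.Nullary using (¬_)

-- Names and alpha-conversion: we use de Bruijn indices (names = ℕ).
-- Binders (input x(y).P and restriction (νx)P) bind index 0 of their body;
-- terms up to alpha-conversion are then just syntactic terms.

infixr 6 _∣_

data Proc : Set where
  nil  : Proc
  inp  : ℕ → Proc → Proc
  out  : ℕ → ℕ → Proc → Proc
  _∣_  : Proc → Proc → Proc
  ν    : Proc → Proc
  !_   : Proc → Proc

ext : (ℕ → ℕ) → ℕ → ℕ
ext ρ zero    = zero
ext ρ (suc i) = suc (ρ i)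

ren : (ℕ → ℕ) → Proc → Proc
ren ρ nil         = nil
ren ρ (inp x P)   = inp (ρ x) (ren (ext ρ) P)
ren ρ (out x y P) = out (ρ x) (ρ y) (ren ρ P)
ren ρ (P ∣ Q)     = ren ρ P ∣ ren ρ Q
ren ρ (ν P)       = ν (ren (ext ρ) P)
ren ρ (! P)       = ! (ren ρ P)

inst : ℕ → ℕ → ℕ
inst z zero    = z
inst z (suc i) = i

swap : ℕ → ℕ
swap zero          = suc zero
swap (suc zero)    = zero
swap (suc (suc i)) = suc (suc i)

shift : Proc → Proc
shift = ren suc

-- Actions: xy (input), x̄y (output), x̄(y) (bound output), τ.
-- For a bound output the extruded name is index 0 of the residual.

data Act : Set where
  ain   : ℕ → ℕ → Act
  aout  : ℕ → ℕ → Act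
  about : ℕ → Act
  τ     : Act

-- an action not mentioning index 0 (y ∉ n(μ)), as seen below a binder
shiftAct : Act → Act
shiftAct (ain x y)  = ain (suc x) (suc y)
shiftAct (aout x y) = aout (suc x) (suc y)
shiftAct (about x)  = about (suc x)
shiftAct τ          = τ

-- side process of a Par rule: shifted past the bound name of a bound output
-- (this is the condition bn(μ) ∩ fn(Q) = ∅)
bump : Act → Proc → Proc
bump (about _) Q = shift Q
bump _         Q = Q

resν : Act → Proc → Proc
resν (about _) P' = ν (ren swap P')
resν _         P' = ν P'

infix 4 _─[_]→_

data _─[_]→_ : Proc → Act → Proc → Set where
  Input  : ∀ {x z P} → inp x P ─[ ain x z ]→ ren (inst z) P
  Output : ∀ {x y P} → out x y P ─[ aout x y ]→ P
  Open   : ∀ {x P P'} → P ─[ aout (suc x) zero ]→ P' → ν P ─[ about x ]→ P'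
  Res    : ∀ {μ P P'} → P ─[ shiftAct μ ]→ P' → ν P ─[ μ ]→ resν μ P'
  ParL   : ∀ {μ P P' Q} → P ─[ μ ]→ P' → P ∣ Q ─[ μ ]→ P' ∣ bump μ Q
  ParR   : ∀ {μ P Q Q'} → Q ─[ μ ]→ Q' → P ∣ Q ─[ μ ]→ bump μ P ∣ Q'
  ComL   : ∀ {x y P P' Q Q'} → P ─[ ain x y ]→ P' → Q ─[ aout x y ]→ Q' →
           P ∣ Q ─[ τ ]→ P' ∣ Q'
  ComR   : ∀ {x y P P' Q Q'} → P ─[ aout x y ]→ P' → Q ─[ ain x y ]→ Q' →
           P ∣ Q ─[ τ ]→ P' ∣ Q'
  -- Close: the receiver gets the fresh name (index 0 after shifting), y ∉ fn(P)
  CloseL : ∀ {x P P' Q Q'} → shift P ─[ ain (suc x) zero ]→ P' → Q ─[ about x ]→ Q' →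
           P ∣ Q ─[ τ ]→ ν (P' ∣ Q')
  CloseR : ∀ {x P P' Q Q'} → P ─[ about x ]→ P' → shift Q ─[ ain (suc x) zero ]→ Q' →
           P ∣ Q ─[ τ ]→ ν (P' ∣ Q')
  Rep    : ∀ {μ P P'} → P ─[ μ ]→ P' → ! P ─[ μ ]→ P' ∣ bump μ (! P)

-- Labels ⟨s,n⟩ ∈ {0,1}* × ℕ   (0 = false, 1 = true)

Label : Set
Label = List Bool × ℕ

_⊑_ : List Bool → List Bool → Set
s₀ ⊑ s₁ = Σ (List Bool) λ t → s₀ ++ t ≡ s₁

_ℜ_ : List Label → List Label → Set
L₀ ℜ L₁ = ∀ {s₀ n₀ s₁ n₁} → (s₀ , n₀) ∈ L₀ → (s₁ , n₁) ∈ L₁ →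
          ¬ (s₀ ⊑ s₁) × ¬ (s₁ ⊑ s₀)

data LProc : Set where
  lnil  : LProc
  linp  : Label → ℕ → LProc → LProc
  lout  : Label → ℕ → ℕ → LProc → LProc
  _∥_   : LProc → LProc → LProc
  lν    : LProc → LProc
  lbang : Label → Proc → LProc

Lab : List Bool → ℕ → Proc → LProc
Lab s n nil         = lnil
Lab s n (inp x P)   = linp (s , n) x (Lab s (suc n) P)
Lab s n (out x y P) = lout (s , n) x y (Lab s (suc n) P)
Lab s n (P ∣ Q)     = Lab (s ++ false ∷ []) n P ∥ Lab (s ++ true ∷ []) n Q
Lab s n (ν P)       = lν (Lab s n P)
Lab s n (! P)       = lbang (s , n) P

top : LProc → List Label
top lnil          = []
top (linp v _ _)  = v ∷ []
top (lout v _ _ _) = v ∷ []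
top (lν E)        = top E
top (E ∥ F)       = top E ++ top F
top (lbang v _)   = v ∷ []

lab : LProc → List Label
lab lnil           = []
lab (linp v _ E)   = v ∷ lab E
lab (lout v _ _ E) = v ∷ lab E
lab (lν E)         = lab E
lab (E ∥ F)        = lab E ++ lab F
lab (lbang v _)    = v ∷ []

data WF : LProc → Set where
  wf-nil  : WF lnil
  wf-inp  : ∀ s n x P → WF (Lab s n (inp x P))
  wf-out  : ∀ s n x y P → WF (Lab s n (out x y P))
  wf-par  : ∀ {E₀ E₁} → WF E₀ → WF E₁ → top E₀ ℜ top E₁ → WF (E₀ ∥ E₁)
  wf-ν    : ∀ {E} → WF E → WF (lν E)
  wf-bang : ∀ v P → WF (lbang v P)

lren : (ℕ → ℕ) → LProc → LProc
lren ρ lnil           = lnil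
lren ρ (linp v x E)   = linp v (ρ x) (lren (ext ρ) E)
lren ρ (lout v x y E) = lout v (ρ x) (ρ y) (lren ρ E)
lren ρ (E ∥ F)        = lren ρ E ∥ lren ρ F
lren ρ (lν E)         = lν (lren (ext ρ) E)
lren ρ (lbang v P)    = lbang v (ren ρ P)

lshift : LProc → LProc
lshift = lren suc

lbump : Act → LProc → LProc
lbump (about _) F = lshift F
lbump _         F = F

lresν : Act → LProc → LProc
lresν (about _) E' = lν (lren swap E')
lresν _         E' = lν E'

pbump : Act → Proc → Proc
pbump (about _) P = shift P
pbump _         P = P

infix 4 _─[_]→ᴸ_

data _─[_]→ᴸ_ : LProc → Act → LProc → Set where
  Input  : ∀ {v x z E} → linp v x E ─[ ain x z ]→ᴸ lren (inst z) E
  Output : ∀ {v x y E} → lout v x y E ─[ aout x y ]→ᴸ E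
  Open   : ∀ {x E E'} → E ─[ aout (suc x) zero ]→ᴸ E' → lν E ─[ about x ]→ᴸ E'
  Res    : ∀ {μ E E'} → E ─[ shiftAct μ ]→ᴸ E' → lν E ─[ μ ]→ᴸ lresν μ E'
  ParL   : ∀ {μ E E' F} → E ─[ μ ]→ᴸ E' → E ∥ F ─[ μ ]→ᴸ E' ∥ lbump μ F
  ParR   : ∀ {μ E F F'} → F ─[ μ ]→ᴸ F' → E ∥ F ─[ μ ]→ᴸ lbump μ E ∥ F'
  ComL   : ∀ {x y E E' F F'} → E ─[ ain x y ]→ᴸ E' → F ─[ aout x y ]→ᴸ F' →
           E ∥ F ─[ τ ]→ᴸ E' ∥ F'
  ComR   : ∀ {x y E E' F F'} → E ─[ aout x y ]→ᴸ E' → F ─[ ain x y ]→ᴸ F' →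
           E ∥ F ─[ τ ]→ᴸ E' ∥ F'
  CloseL : ∀ {x E E' F F'} → lshift E ─[ ain (suc x) zero ]→ᴸ E' → F ─[ about x ]→ᴸ F' →
           E ∥ F ─[ τ ]→ᴸ lν (E' ∥ F')
  CloseR : ∀ {x E E' F F'} → E ─[ about x ]→ᴸ E' → lshift F ─[ ain (suc x) zero ]→ᴸ F' →
           E ∥ F ─[ τ ]→ᴸ lν (E' ∥ F')
  Rep    : ∀ {μ s n P P'} → P ─[ μ ]→ P' →
           lbang (s , n) P ─[ μ ]→ᴸ
             Lab (s ++ false ∷ []) (suc n) P' ∥ lbang (s ++ true ∷ [] , suc n) (pbump μ P)

Unl : LProc → Proc
Unl lnil           = nil
Unl (linp _ x E)   = inp x (Unl E)
Unl (lout _ x y E) = out x y (Unl E)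
Unl (E ∥ F)        = Unl E ∣ Unl F
Unl (lν E)         = ν (Unl E)
Unl (lbang _ P)    = ! P

module Submission where

-- Labels never influence which transitions exist, so erasing them commutes
-- with every rule (part 1) and any derivation from Unl E can be replayed
-- rule by rule on E (part 2). The replayed target is well formed because a
-- step only replaces top labels by extensions of them: the incomparability
-- required at each parallel composition is inherited by extensions, and the
-- two components created by Rep carry the incomparable branches s0 and s1.

open import Defs
open import Data.Bool using (Bool; true; false)
open import Data.List using (List; []; _∷_; _++_)
open import Data.List.Properties using (∷-injective; ++-assoc; ++-identityʳ)
open import Data.List.Membership.Propositional using (_∈_)
open import Data.List.Membership.Propositional.Properties using (∈-++⁻; ∈-++⁺ˡ; ∈-++⁺ʳ)
open import Data.List.Relation.Unary.Any using (here)
open import Data.Nat using (ℕ; zero; suc)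
open import Data.Product using (_×_; Σ; _,_; proj₁)
open import Data.Sum using (_⊎_; inj₁; inj₂)
open import Relation.Binary.PropositionalEquality
  using (_≡_; refl; sym; trans; cong; cong₂; subst; subst₂)
open import Relation.Nullary using (¬_)

Unl-lren : ∀ ρ E → Unl (lren ρ E) ≡ ren ρ (Unl E)
Unl-lren ρ lnil           = refl
Unl-lren ρ (linp v x E)   = cong (inp (ρ x)) (Unl-lren (ext ρ) E)
Unl-lren ρ (lout v x y E) = cong (out (ρ x) (ρ y)) (Unl-lren ρ E)
Unl-lren ρ (E ∥ F)        = cong₂ _∣_ (Unl-lren ρ E) (Unl-lren ρ F)
Unl-lren ρ (lν E)         = cong ν (Unl-lren (ext ρ) E)
Unl-lren ρ (lbang v P)    = refl

Unl-Lab : ∀ s n P → Unl (Lab s n P) ≡ P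
Unl-Lab s n nil         = refl
Unl-Lab s n (inp x P)   = cong (inp x) (Unl-Lab s (suc n) P)
Unl-Lab s n (out x y P) = cong (out x y) (Unl-Lab s (suc n) P)
Unl-Lab s n (P ∣ Q)     = cong₂ _∣_ (Unl-Lab _ n P) (Unl-Lab _ n Q)
Unl-Lab s n (ν P)       = cong ν (Unl-Lab s n P)
Unl-Lab s n (! P)       = refl

Unl-lbump : ∀ μ F → Unl (lbump μ F) ≡ bump μ (Unl F)
Unl-lbump (ain _ _)  F = refl
Unl-lbump (aout _ _) F = refl
Unl-lbump (about _)  F = Unl-lren suc F
Unl-lbump τ          F = refl

Unl-lresν : ∀ μ E → Unl (lresν μ E) ≡ resν μ (Unl E)
Unl-lresν (ain _ _)  E = refl
Unl-lresν (aout _ _) E = refl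
Unl-lresν (about _)  E = cong ν (Unl-lren swap E)
Unl-lresν τ          E = refl

bump-! : ∀ μ P → bump μ (! P) ≡ ! (pbump μ P)
bump-! (ain _ _)  P = refl
bump-! (aout _ _) P = refl
bump-! (about _)  P = refl
bump-! τ          P = refl

Unl-step : ∀ {E μ E'} → E ─[ μ ]→ᴸ E' → Unl E ─[ μ ]→ Unl E'
Unl-step (Input {x = x} {z} {E}) =
  subst (inp x (Unl E) ─[ ain x z ]→_) (sym (Unl-lren (inst z) E)) Input
Unl-step Output     = Output
Unl-step (Open d)   = Open (Unl-step d)
Unl-step (Res {μ} {E} {E'} d) =
  subst (ν (Unl E) ─[ μ ]→_) (sym (Unl-lresν μ E')) (Res (Unl-step d))
Unl-step (ParL {μ} {E} {E'} {F} d) =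
  subst (λ R → Unl E ∣ Unl F ─[ μ ]→ Unl E' ∣ R) (sym (Unl-lbump μ F)) (ParL (Unl-step d))
Unl-step (ParR {μ} {E} {F} {F'} d) =
  subst (λ R → Unl E ∣ Unl F ─[ μ ]→ R ∣ Unl F') (sym (Unl-lbump μ E)) (ParR (Unl-step d))
Unl-step (ComL d e) = ComL (Unl-step d) (Unl-step e)
Unl-step (ComR d e) = ComR (Unl-step d) (Unl-step e)
Unl-step (CloseL {x} {E} {E'} d e) =
  CloseL (subst (_─[ ain (suc x) zero ]→ Unl E') (Unl-lren suc E) (Unl-step d)) (Unl-step e)
Unl-step (CloseR {x} {F = F} {F'} d e) =
  CloseR (Unl-step d) (subst (_─[ ain (suc x) zero ]→ Unl F') (Unl-lren suc F) (Unl-step e))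
Unl-step (Rep {μ} {n = n} {P} {P'} d) =
  subst₂ (λ A B → ! P ─[ μ ]→ A ∣ B) (sym (Unl-Lab _ (suc n) P')) (bump-! μ P) (Rep d)

-- Stated for any P with Unl E ≡ P so that the Close cases may recurse on
-- lshift E, whose erasure is shift (Unl E) only up to propositional equality.
lift-step : ∀ E {P μ P'} → Unl E ≡ P → P ─[ μ ]→ P' →
            Σ LProc (λ E' → (E ─[ μ ]→ᴸ E') × Unl E' ≡ P')
lift-step (linp v x E) refl (Input {z = z}) = lren (inst z) E , Input , Unl-lren (inst z) E
lift-step (lout v x y E) refl Output = E , Output , refl
lift-step (lν E) refl (Open d) with lift-step E refl d
... | E' , t , eq = E' , Open t , eq
lift-step (lν E) refl (Res {μ} d) with lift-step E refl d
... | E' , t , eq = lresν μ E' , Res t , trans (Unl-lresν μ E') (cong (resν μ) eq)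
lift-step (E ∥ F) refl (ParL {μ} d) with lift-step E refl d
... | E' , t , eq = E' ∥ lbump μ F , ParL t , cong₂ _∣_ eq (Unl-lbump μ F)
lift-step (E ∥ F) refl (ParR {μ} d) with lift-step F refl d
... | F' , t , eq = lbump μ E ∥ F' , ParR t , cong₂ _∣_ (Unl-lbump μ E) eq
lift-step (E ∥ F) refl (ComL d e) with lift-step E refl d | lift-step F refl e
... | E' , t , eq | F' , u , eq' = E' ∥ F' , ComL t u , cong₂ _∣_ eq eq'
lift-step (E ∥ F) refl (ComR d e) with lift-step E refl d | lift-step F refl e
... | E' , t , eq | F' , u , eq' = E' ∥ F' , ComR t u , cong₂ _∣_ eq eq'
lift-step (E ∥ F) refl (CloseL d e)
  with lift-step (lshift E) (Unl-lren suc E) d | lift-step F refl e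
... | E' , t , eq | F' , u , eq' = lν (E' ∥ F') , CloseL t u , cong ν (cong₂ _∣_ eq eq')
lift-step (E ∥ F) refl (CloseR d e)
  with lift-step E refl d | lift-step (lshift F) (Unl-lren suc F) e
... | E' , t , eq | F' , u , eq' = lν (E' ∥ F') , CloseR t u , cong ν (cong₂ _∣_ eq eq')
lift-step (lbang (s , n) P) refl (Rep {μ} {P' = P'} d) =
  Lab (s ++ false ∷ []) (suc n) P' ∥ lbang (s ++ true ∷ [] , suc n) (pbump μ P) , Rep d ,
  cong₂ _∣_ (Unl-Lab _ (suc n) P') (sym (bump-! μ P))

⊑-refl : ∀ s → s ⊑ s
⊑-refl s = [] , ++-identityʳ s

⊑-trans : ∀ {a b c} → a ⊑ b → b ⊑ c → a ⊑ c
⊑-trans {a} (u , p) (v , q) = u ++ v , trans (sym (++-assoc a u v)) (trans (cong (_++ v) p) q)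

⊑-snoc : ∀ s b → s ⊑ (s ++ b ∷ [])
⊑-snoc s b = b ∷ [] , refl

prefixes-comparable : ∀ {s t b} → s ⊑ b → t ⊑ b → s ⊑ t ⊎ t ⊑ s
prefixes-comparable {[]}    {t}              _       _ = inj₁ (t , refl)
prefixes-comparable {x ∷ s} {[]}             _       _ = inj₂ (x ∷ s , refl)
prefixes-comparable {x ∷ s} {y ∷ t} {z ∷ b} (u , p) (v , q)
  with ∷-injective p | ∷-injective q
... | refl , p' | refl , q' with prefixes-comparable {s} {t} {b} (u , p') (v , q')
... | inj₁ (w , r) = inj₁ (w , cong (x ∷_) r)
... | inj₂ (w , r) = inj₂ (w , cong (x ∷_) r)

Incomparable : List Bool → List Bool → Set
Incomparable s t = ¬ s ⊑ t × ¬ t ⊑ s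

incomparable-extend : ∀ {s t a b} → s ⊑ a → t ⊑ b → Incomparable s t → Incomparable a b
incomparable-extend sa tb (s⋢t , t⋢s) = one-way sa tb s⋢t t⋢s , one-way tb sa t⋢s s⋢t
  where
  one-way : ∀ {s t a b} → s ⊑ a → t ⊑ b → ¬ s ⊑ t → ¬ t ⊑ s → ¬ a ⊑ b
  one-way sa tb s⋢t t⋢s a⊑b with prefixes-comparable (⊑-trans sa a⊑b) tb
  ... | inj₁ s⊑t = s⋢t s⊑t
  ... | inj₂ t⊑s = t⋢s t⊑s

branches-incomparable : ∀ s → Incomparable (s ++ false ∷ []) (s ++ true ∷ [])
branches-incomparable s = no-branch-prefix s (λ ()) , no-branch-prefix s (λ ())
  where
  no-branch-prefix : ∀ s {b c : Bool} → ¬ b ≡ c → ¬ (s ++ b ∷ []) ⊑ (s ++ c ∷ [])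
  no-branch-prefix []      b≢c (u , p) = b≢c (proj₁ (∷-injective p))
  no-branch-prefix (x ∷ s) b≢c (u , p) with ∷-injective p
  ... | _ , p' = no-branch-prefix s b≢c (u , p')

top-Lab-extends : ∀ P s m {s' n'} → (s' , n') ∈ top (Lab s m P) → s ⊑ s'
top-Lab-extends (inp x P)   s m (here refl) = ⊑-refl s
top-Lab-extends (out x y P) s m (here refl) = ⊑-refl s
top-Lab-extends (! P)       s m (here refl) = ⊑-refl s
top-Lab-extends (ν P)       s m mem         = top-Lab-extends P s m mem
top-Lab-extends (P ∣ Q)     s m mem with ∈-++⁻ (top (Lab (s ++ false ∷ []) m P)) mem
... | inj₁ mem' = ⊑-trans (⊑-snoc s false) (top-Lab-extends P _ m mem')
... | inj₂ mem' = ⊑-trans (⊑-snoc s true) (top-Lab-extends Q _ m mem')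

top-lren : ∀ ρ E → top (lren ρ E) ≡ top E
top-lren ρ lnil           = refl
top-lren ρ (linp v x E)   = refl
top-lren ρ (lout v x y E) = refl
top-lren ρ (E ∥ F)        = cong₂ _++_ (top-lren ρ E) (top-lren ρ F)
top-lren ρ (lν E)         = top-lren (ext ρ) E
top-lren ρ (lbang v P)    = refl

top-lbump : ∀ μ E → top (lbump μ E) ≡ top E
top-lbump (ain _ _)  E = refl
top-lbump (aout _ _) E = refl
top-lbump (about _)  E = top-lren suc E
top-lbump τ          E = refl

top-lresν : ∀ μ E → top (lresν μ E) ≡ top E
top-lresν (ain _ _)  E = refl
top-lresν (aout _ _) E = refl
top-lresν (about _)  E = top-lren swap E
top-lresν τ          E = refl

lren-Lab : ∀ ρ s n P → lren ρ (Lab s n P) ≡ Lab s n (ren ρ P)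
lren-Lab ρ s n nil         = refl
lren-Lab ρ s n (inp x P)   = cong (linp (s , n) (ρ x)) (lren-Lab (ext ρ) s (suc n) P)
lren-Lab ρ s n (out x y P) = cong (lout (s , n) (ρ x) (ρ y)) (lren-Lab ρ s (suc n) P)
lren-Lab ρ s n (P ∣ Q)     = cong₂ _∥_ (lren-Lab ρ _ n P) (lren-Lab ρ _ n Q)
lren-Lab ρ s n (ν P)       = cong lν (lren-Lab (ext ρ) s n P)
lren-Lab ρ s n (! P)       = refl

WF-Lab : ∀ P s n → WF (Lab s n P)
WF-Lab nil         s n = wf-nil
WF-Lab (inp x P)   s n = wf-inp s n x P
WF-Lab (out x y P) s n = wf-out s n x y P
WF-Lab (ν P)       s n = wf-ν (WF-Lab P s n)
WF-Lab (! P)       s n = wf-bang (s , n) P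
WF-Lab (P ∣ Q)     s n = wf-par (WF-Lab P _ n) (WF-Lab Q _ n) λ m₀ m₁ →
  incomparable-extend (top-Lab-extends P _ n m₀) (top-Lab-extends Q _ n m₁)
                      (branches-incomparable s)

WF-lren : ∀ ρ {E} → WF E → WF (lren ρ E)
WF-lren ρ wf-nil = wf-nil
WF-lren ρ (wf-inp s n x P) =
  subst WF (sym (lren-Lab ρ s n (inp x P))) (WF-Lab (ren ρ (inp x P)) s n)
WF-lren ρ (wf-out s n x y P) =
  subst WF (sym (lren-Lab ρ s n (out x y P))) (WF-Lab (ren ρ (out x y P)) s n)
WF-lren ρ (wf-par {E₀} {E₁} w₀ w₁ r) =
  wf-par (WF-lren ρ w₀) (WF-lren ρ w₁) (subst₂ _ℜ_ (sym (top-lren ρ E₀)) (sym (top-lren ρ E₁)) r)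
WF-lren ρ (wf-ν w) = wf-ν (WF-lren (ext ρ) w)
WF-lren ρ (wf-bang v P) = wf-bang v (ren ρ P)

WF-lbump : ∀ μ {E} → WF E → WF (lbump μ E)
WF-lbump (ain _ _)  w = w
WF-lbump (aout _ _) w = w
WF-lbump (about _)  w = WF-lren suc w
WF-lbump τ          w = w

WF-lresν : ∀ μ {E} → WF E → WF (lresν μ E)
WF-lresν (ain _ _)  w = wf-ν w
WF-lresν (aout _ _) w = wf-ν w
WF-lresν (about _)  w = wf-ν (WF-lren swap w)
WF-lresν τ          w = wf-ν w

_≼_ : List Label → List Label → Set
L' ≼ L = ∀ {s' n'} → (s' , n') ∈ L' → Σ (List Bool) λ s → Σ ℕ λ n → ((s , n) ∈ L) × s ⊑ s'

≼-reflexive : ∀ {L' L} → L' ≡ L → L' ≼ L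
≼-reflexive refl {s'} {n'} m = s' , n' , m , ⊑-refl s'

≼-trans : ∀ {A B C} → A ≼ B → B ≼ C → A ≼ C
≼-trans A≼B B≼C m with A≼B m
... | _ , _ , m' , p with B≼C m'
... | s , n , m'' , q = s , n , m'' , ⊑-trans q p

≼-++ : ∀ {A' A B' B} → A' ≼ A → B' ≼ B → (A' ++ B') ≼ (A ++ B)
≼-++ {A'} {A} A'≼A B'≼B m with ∈-++⁻ A' m
... | inj₁ m' with A'≼A m'
... | s , n , mm , p = s , n , ∈-++⁺ˡ mm , p
≼-++ {A'} {A} A'≼A B'≼B m | inj₂ m' with B'≼B m'
... | s , n , mm , p = s , n , ∈-++⁺ʳ A mm , p

ℜ-antimono : ∀ {L₀ L₁ L₀' L₁'} → L₀ ℜ L₁ → L₀' ≼ L₀ → L₁' ≼ L₁ → L₀' ℜ L₁'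
ℜ-antimono r le₀ le₁ m₀ m₁ with le₀ m₀ | le₁ m₁
... | _ , _ , ma , p | _ , _ , mb , q = incomparable-extend p q (r ma mb)

top-Lab-≼ : ∀ P s n → top (Lab s (suc n) P) ≼ ((s , n) ∷ [])
top-Lab-≼ P s n m = s , n , here refl , top-Lab-extends P s (suc n) m

WF-Rep-residual : ∀ s n P' Q → WF (Lab (s ++ false ∷ []) (suc n) P' ∥ lbang (s ++ true ∷ [] , suc n) Q)
WF-Rep-residual s n P' Q = wf-par (WF-Lab P' _ (suc n)) (wf-bang _ Q) λ { m₀ (here refl) →
  incomparable-extend (top-Lab-extends P' _ (suc n) m₀) (⊑-refl _) (branches-incomparable s) }

top-Rep-residual-≼ : ∀ s n P' Q →
  top (Lab (s ++ false ∷ []) (suc n) P' ∥ lbang (s ++ true ∷ [] , suc n) Q) ≼ ((s , n) ∷ [])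
top-Rep-residual-≼ s n P' Q m with ∈-++⁻ (top (Lab (s ++ false ∷ []) (suc n) P')) m
... | inj₁ m' = s , n , here refl , ⊑-trans (⊑-snoc s false) (top-Lab-extends P' _ (suc n) m')
... | inj₂ (here refl) = s , n , here refl , ⊑-snoc s true

step-preserves-WF : ∀ {E μ E'} → WF E → E ─[ μ ]→ᴸ E' → WF E' × top E' ≼ top E
step-preserves-WF (wf-inp s n x P) (Input {z = z}) =
  subst WF (sym (lren-Lab (inst z) s (suc n) P)) (WF-Lab (ren (inst z) P) s (suc n)) ,
  ≼-trans (≼-reflexive (top-lren (inst z) (Lab s (suc n) P))) (top-Lab-≼ P s n)
step-preserves-WF (wf-out s n x y P) Output = WF-Lab P s (suc n) , top-Lab-≼ P s n
step-preserves-WF (wf-ν w) (Open d) = step-preserves-WF w d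
step-preserves-WF (wf-ν w) (Res {μ} {E' = E'} d) with step-preserves-WF w d
... | w' , le = WF-lresν μ w' , ≼-trans (≼-reflexive (top-lresν μ E')) le
step-preserves-WF (wf-par {E₁ = E₁} w₀ w₁ r) (ParL {μ} d) with step-preserves-WF w₀ d
... | w' , le = wf-par w' (WF-lbump μ w₁) (ℜ-antimono r le same) , ≼-++ le same
  where same = ≼-reflexive (top-lbump μ E₁)
step-preserves-WF (wf-par {E₀} w₀ w₁ r) (ParR {μ} d) with step-preserves-WF w₁ d
... | w' , le = wf-par (WF-lbump μ w₀) w' (ℜ-antimono r same le) , ≼-++ same le
  where same = ≼-reflexive (top-lbump μ E₀)
step-preserves-WF (wf-par w₀ w₁ r) (ComL d e)
  with step-preserves-WF w₀ d | step-preserves-WF w₁ e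
... | w' , le | v' , le' = wf-par w' v' (ℜ-antimono r le le') , ≼-++ le le'
step-preserves-WF (wf-par w₀ w₁ r) (ComR d e)
  with step-preserves-WF w₀ d | step-preserves-WF w₁ e
... | w' , le | v' , le' = wf-par w' v' (ℜ-antimono r le le') , ≼-++ le le'
step-preserves-WF (wf-par {E₀} w₀ w₁ r) (CloseL d e)
  with step-preserves-WF (WF-lren suc w₀) d | step-preserves-WF w₁ e
... | w' , le | v' , le' = wf-ν (wf-par w' v' (ℜ-antimono r le₀ le')) , ≼-++ le₀ le'
  where le₀ = ≼-trans le (≼-reflexive (top-lren suc E₀))
step-preserves-WF (wf-par {E₁ = E₁} w₀ w₁ r) (CloseR d e)
  with step-preserves-WF w₀ d | step-preserves-WF (WF-lren suc w₁) e
... | w' , le | v' , le' = wf-ν (wf-par w' v' (ℜ-antimono r le le₁)) , ≼-++ le le₁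
  where le₁ = ≼-trans le' (≼-reflexive (top-lren suc E₁))
step-preserves-WF (wf-bang (s , n) P) (Rep {μ} {P' = P'} d) =
  WF-Rep-residual s n P' (pbump μ P) , top-Rep-residual-≼ s n P' (pbump μ P)

proposition4p11 : (E : LProc) → WF E →
    (∀ {μ E'} → E ─[ μ ]→ᴸ E' → Unl E ─[ μ ]→ Unl E') ×
    (∀ {μ P'} → Unl E ─[ μ ]→ P' →
       Σ LProc (λ E' → WF E' × (E ─[ μ ]→ᴸ E') × Unl E' ≡ P'))
proposition4p11 E wf = Unl-step , lift-well-formed
  where
  lift-well-formed : ∀ {μ P'} → Unl E ─[ μ ]→ P' →
                     Σ LProc (λ E' → WF E' × (E ─[ μ ]→ᴸ E') × Unl E' ≡ P')
  lift-well-formed d with lift-step E refl d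
  ... | E' , t , eq = E' , proj₁ (step-preserves-WF wf t) , t , eq
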